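{- A graph $G$ is a $DD_2$-graph if and only if $G$ has a spanning bipartite subgraph $H=(A,B,E_H)$ (with bipartition $A,B$) such that $d_H(a)\ge 2$ for every $a\in A$ and $d_H(b)\ge 1$ for every $b\in B$.
   Context: All graphs are finite and simple. A set $D\subseteq V_G$ is dominating if every vertex of $V_G-D$ has a neighbor in $D$; it is 2-dominating if every vertex of $V_G-D$ has at least two neighbors in $D$. A $DD_2$-pair in $G$ is a pair $(D,D_2)$ of disjoint subsets of $V_G$ such that $D$ is dominating and $D_2$ is 2-dominating in $G$. A graph is a $DD_2$-graph if it has a $DD_2$-pair. $d_H(v)$ denotes the degree of $v$ in $H$. -}

module Defs where

open import Data.Nat using (ℕ; _≤_; _+_)
open import Data.Bool using (Bool; true; false; _∧_; if_then_else_)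
open import Data.Fin using (Fin)
open import Data.Fin.Subset using (Subset; _∈_; _∉_)
open import Data.Vec using (lookup)
open import Data.List using (List; map; allFin)
open import Data.Nat.ListAction using (sum)
open import Data.Product using (Σ; _×_; ∃-syntax)
open import Relation.Binary.PropositionalEquality using (_≡_; _≢_)

record Graph (n : ℕ) : Set where
  field
    adj    : Fin n → Fin n → Bool
    adj-sym : ∀ u v → adj u v ≡ adj v u
    adj-irr : ∀ v → adj v v ≡ false
open Graph public

nbrsIn : ∀ {n} → Graph n → Fin n → Subset n → ℕ
nbrsIn {n} G v S = sum (map (λ u → if adj G v u ∧ lookup S u then 1 else 0) (allFin n))

degree : ∀ {n} → Graph n → Fin n → ℕ
degree {n} G v = sum (map (λ u → if adj G v u then 1 else 0) (allFin n))

IsDominating : ∀ {n} → Graph n → Subset n → Set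
IsDominating G D = ∀ v → v ∉ D → ∃[ u ] (u ∈ D × adj G v u ≡ true)

Is2Dominating : ∀ {n} → Graph n → Subset n → Set
Is2Dominating G D = ∀ v → v ∉ D → 2 ≤ nbrsIn G v D

Disjoint : ∀ {n} → Subset n → Subset n → Set
Disjoint D D₂ = ∀ v → v ∈ D → v ∉ D₂

IsDD2Pair : ∀ {n} → Graph n → Subset n → Subset n → Set
IsDD2Pair G D D₂ = Disjoint D D₂ × IsDominating G D × Is2Dominating G D₂

IsDD2Graph : ∀ {n} → Graph n → Set
IsDD2Graph {n} G = Σ (Subset n) λ D → Σ (Subset n) λ D₂ → IsDD2Pair G D D₂

IsSpanningSubgraph : ∀ {n} → Graph n → Graph n → Set
IsSpanningSubgraph H G = ∀ u v → adj H u v ≡ true → adj G u v ≡ true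

-- H is bipartite with bipartition A = side⁻¹(true), B = side⁻¹(false)
IsBipartition : ∀ {n} → Graph n → (Fin n → Bool) → Set
IsBipartition H side = ∀ u v → adj H u v ≡ true → side u ≢ side v

DegreeCondition : ∀ {n} → Graph n → (Fin n → Bool) → Set
DegreeCondition H side =
  ∀ v → (side v ≡ true → 2 ≤ degree H v) × (side v ≡ false → 1 ≤ degree H v)

-- Put A = V − D₂ and B = D₂, and keep the edges of G between A and B.  Every
-- vertex outside D₂ has two neighbours in D₂, and every vertex of D₂ lies
-- outside D, hence has a neighbour in D ⊆ A; so the degree condition holds.
-- Conversely, for such an H the sides D = A and D₂ = B form a DD₂-pair,
-- because every H-neighbour of a vertex lies on the opposite side.
module Submission where

open import Defs
open import Data.Nat using (ℕ; _≤_; z≤n)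
open import Data.Nat.Properties using (≤-trans; +-mono-≤; ≤-refl; m≤m+n; m≤n+m)
open import Data.Nat.ListAction using (sum)
open import Data.Bool using (Bool; true; false; _∧_; not; _xor_; if_then_else_)
open import Data.Bool.Properties using (xor-comm; ¬-not)
open import Data.Fin using (Fin)
open import Data.Fin.Subset using (Subset; _∈_; _∉_; ∁)
open import Data.Fin.Subset.Properties using (x∈p⇒x∉∁p; x∈∁p⇒x∉p; x∉p⇒x∈∁p; x∉∁p⇒x∈p)
open import Data.Vec using (lookup; tabulate)
open import Data.Vec.Properties using ([]=⇒lookup; lookup⇒[]=; lookup∘tabulate)
open import Data.List using (List; []; _∷_; map; allFin)
open import Data.List.Relation.Unary.Any using (here; there)
import Data.List.Membership.Propositional as List
open import Data.List.Membership.Propositional.Properties using (∈-allFin)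
open import Data.Product using (Σ; _×_; _,_; proj₁; proj₂; ∃-syntax)
open import Data.Empty using (⊥-elim)
open import Function.Bundles using (_⇔_; mk⇔)
open import Relation.Binary.PropositionalEquality
  using (_≡_; refl; sym; trans; cong; cong₂)

∧≡true⁻ : ∀ {x y} → x ∧ y ≡ true → x ≡ true × y ≡ true
∧≡true⁻ {true}  {true}  _ = refl , refl
∧≡true⁻ {true}  {false} ()
∧≡true⁻ {false}         ()

module _ {A : Set} where

  -- degree G v and nbrsIn G v S unfold to count (adj G v) (allFin n) and
  -- count (λ u → adj G v u ∧ lookup S u) (allFin n).
  count : (A → Bool) → List A → ℕ
  count p xs = sum (map (λ x → if p x then 1 else 0) xs)

  count-mono : ∀ {p q : A → Bool} (xs : List A) →
    (∀ x → p x ≡ true → q x ≡ true) → count p xs ≤ count q xs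
  count-mono []       p⇒q = z≤n
  count-mono {p} {q} (x ∷ xs) p⇒q = +-mono-≤ head-mono (count-mono xs p⇒q)
    where
    head-mono : (if p x then 1 else 0) ≤ (if q x then 1 else 0)
    head-mono with p x in px
    ... | false = z≤n
    ... | true rewrite p⇒q x px = ≤-refl

  count-pos⁺ : ∀ {p : A → Bool} {x xs} → x List.∈ xs → p x ≡ true → 1 ≤ count p xs
  count-pos⁺ {p} {x} {_ ∷ xs} (here refl) px rewrite px = m≤m+n 1 (count p xs)
  count-pos⁺ {p} {x} {y ∷ _}  (there x∈xs) px =
    ≤-trans (count-pos⁺ x∈xs px) (m≤n+m _ (if p y then 1 else 0))

  count-pos⁻ : ∀ {p : A → Bool} (xs : List A) → 1 ≤ count p xs → ∃[ x ] p x ≡ true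
  count-pos⁻ {p} (x ∷ xs) pos with p x in px
  ... | true  = x , px
  ... | false = count-pos⁻ xs pos

module _ {n} {S : Subset n} {v : Fin n} where

  ∉⇒lookup≡false : v ∉ S → lookup S v ≡ false
  ∉⇒lookup≡false v∉S with lookup S v in e
  ... | true  = ⊥-elim (v∉S (lookup⇒[]= v S e))
  ... | false = refl

  lookup≡false⇒∉ : lookup S v ≡ false → v ∉ S
  lookup≡false⇒∉ e v∈S with trans (sym ([]=⇒lookup v∈S)) e
  ... | ()

module _ {n} (f : Fin n → Bool) {v : Fin n} where

  ∈-tabulate⁺ : f v ≡ true → v ∈ tabulate f
  ∈-tabulate⁺ fv = lookup⇒[]= v (tabulate f) (trans (lookup∘tabulate f v) fv)

  ∈-tabulate⁻ : v ∈ tabulate f → f v ≡ true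
  ∈-tabulate⁻ v∈ = trans (sym (lookup∘tabulate f v)) ([]=⇒lookup v∈)

  ∉-tabulate⁺ : f v ≡ false → v ∉ tabulate f
  ∉-tabulate⁺ fv = lookup≡false⇒∉ (trans (lookup∘tabulate f v) fv)

  ∉-tabulate⁻ : v ∉ tabulate f → f v ≡ false
  ∉-tabulate⁻ v∉ = trans (sym (lookup∘tabulate f v)) (∉⇒lookup≡false v∉)

crossing : ∀ {n} → Graph n → (Fin n → Bool) → Graph n
crossing G side = record
  { adj     = λ u v → adj G u v ∧ (side u xor side v)
  ; adj-sym = λ u v → cong₂ _∧_ (adj-sym G u v) (xor-comm (side u) (side v))
  ; adj-irr = irreflexive
  }
  where
  irreflexive : ∀ v → adj G v v ∧ (side v xor side v) ≡ false
  irreflexive v rewrite adj-irr G v = refl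

module _ {n} (G : Graph n) (side : Fin n → Bool) where

  crossing-spanning : IsSpanningSubgraph (crossing G side) G
  crossing-spanning u v e = proj₁ (∧≡true⁻ e)

  crossing-bipartition : IsBipartition (crossing G side) side
  crossing-bipartition u v e with side u | side v | proj₂ (∧≡true⁻ {adj G u v} e)
  ... | true  | false | _ = λ ()
  ... | false | true  | _ = λ ()

  crossing-adj⁺ : ∀ {u v b} → adj G u v ≡ true → side u ≡ b → side v ≡ not b →
    adj (crossing G side) u v ≡ true
  crossing-adj⁺ {b = true}  e su sv rewrite e | su | sv = refl
  crossing-adj⁺ {b = false} e su sv rewrite e | su | sv = refl

neighbour-side : ∀ {n} (H : Graph n) (side : Fin n → Bool) → IsBipartition H side →
  ∀ {u v} → adj H u v ≡ true → side v ≡ not (side u)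
neighbour-side H side bip e = ¬-not (λ eq → bip _ _ e (sym eq))

dd2Pair⇒crossing-degreeCondition : ∀ {n} (G : Graph n) (D D₂ : Subset n) →
  IsDD2Pair G D D₂ → DegreeCondition (crossing G (lookup (∁ D₂))) (lookup (∁ D₂))
dd2Pair⇒crossing-degreeCondition {n} G D D₂ (disjoint , dominating , twoDominating) v =
  onA , onB
  where
  side : Fin n → Bool
  side = lookup (∁ D₂)

  onA : side v ≡ true → 2 ≤ degree (crossing G side) v
  onA sv = ≤-trans (twoDominating v (x∈∁p⇒x∉p (lookup⇒[]= v (∁ D₂) sv)))
                   (count-mono (allFin n) toCrossing)
    where
    toCrossing : ∀ u → adj G v u ∧ lookup D₂ u ≡ true → adj (crossing G side) v u ≡ true
    toCrossing u e with ∧≡true⁻ e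
    ... | vu , u∈D₂ =
      crossing-adj⁺ G side vu sv (∉⇒lookup≡false (x∈p⇒x∉∁p (lookup⇒[]= u D₂ u∈D₂)))

  onB : side v ≡ false → 1 ≤ degree (crossing G side) v
  onB sv with dominating v (λ v∈D → disjoint v v∈D (x∉∁p⇒x∈p (lookup≡false⇒∉ sv)))
  ... | u , u∈D , vu =
    count-pos⁺ (∈-allFin u)
      (crossing-adj⁺ G side vu sv ([]=⇒lookup (x∉p⇒x∈∁p (disjoint u u∈D))))

degreeCondition⇒dd2Pair : ∀ {n} (G H : Graph n) (side : Fin n → Bool) →
  IsSpanningSubgraph H G → IsBipartition H side → DegreeCondition H side →
  IsDD2Pair G (tabulate side) (∁ (tabulate side))
degreeCondition⇒dd2Pair {n} G H side spanning bipartition degrees =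
  (λ _ → x∈p⇒x∉∁p) , dominating , twoDominating
  where
  opposite : ∀ {u v} → adj H u v ≡ true → side v ≡ not (side u)
  opposite = neighbour-side H side bipartition

  dominating : IsDominating G (tabulate side)
  dominating v v∉A = neighbourInA (count-pos⁻ (allFin n) (proj₂ (degrees v) sv))
    where
    sv : side v ≡ false
    sv = ∉-tabulate⁻ side v∉A

    neighbourInA : ∃[ u ] adj H v u ≡ true → ∃[ u ] (u ∈ tabulate side × adj G v u ≡ true)
    neighbourInA (u , vu) =
      u , ∈-tabulate⁺ side (trans (opposite vu) (cong not sv)) , spanning v u vu

  twoDominating : Is2Dominating G (∁ (tabulate side))
  twoDominating v v∉B = ≤-trans (proj₁ (degrees v) sv) (count-mono (allFin n) fromH)
    where
    sv : side v ≡ true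
    sv = ∈-tabulate⁻ side (x∉∁p⇒x∈p v∉B)

    fromH : ∀ u → adj H v u ≡ true → adj G v u ∧ lookup (∁ (tabulate side)) u ≡ true
    fromH u vu = cong₂ _∧_ (spanning v u vu)
      ([]=⇒lookup (x∉p⇒x∈∁p (∉-tabulate⁺ side (trans (opposite vu) (cong not sv)))))

mainTheorem1 : ∀ {n} (G : Graph n) →
    IsDD2Graph G ⇔
      Σ (Graph n) λ H → Σ (Fin n → Bool) λ side →
        IsSpanningSubgraph H G × IsBipartition H side × DegreeCondition H side
mainTheorem1 G = mk⇔
  (λ (D , D₂ , pair) →
    let side = lookup (∁ D₂) in
    crossing G side , side , crossing-spanning G side , crossing-bipartition G side ,
    dd2Pair⇒crossing-degreeCondition G D D₂ pair)
  (λ (H , side , spanning , bipartition , degrees) →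
    tabulate side , ∁ (tabulate side) ,
    degreeCondition⇒dd2Pair G H side spanning bipartition degrees)
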